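{- In the branch structure $\mathcal{M}_{\mathcal{B}}=\langle U,D,\tilde\neg,\tilde\to,\tilde\equiv\rangle$ defined in the context, $\tilde\to$ is a function on $U$ (each pair $(w,v)\in U\times U$ is assigned exactly one value) and for all $w,v\in U$: $w\tilde\to v\in D$ iff $w\notin D$ or $v\in D$.
   Context: SCI-formulas: over a countably infinite set $\mathsf{AF}$ of atoms, $\varphi ::= p \mid \neg\varphi \mid \varphi\to\varphi \mid \varphi\equiv\varphi$; $\mathsf{FOR}$ is the set of formulas. Tableau system $\mathsf{TC}_{\mathsf{SCI}}$. Let $\mathsf{L}^+,\mathsf{L}^-$ be disjoint countably infinite sets of labels, $\mathsf{L}=\mathsf{L}^+\cup\mathsf{L}^-$; a label written $w^+$ lies in $\mathsf{L}^+$, $w^-$ in $\mathsf{L}^-$, unsuperscripted labels are arbitrary. A labelled formula is $w:\varphi$; equality statements $w=v$ and inequality statements $w\neq v$ may also occur. A tableau is a tree whose nodes carry these items or $\bot$; a branch is a root-to-leaf path identified with its set of items. Rules (premises / alternative conclusion sets separated by $\mid$): decomposition rules (conclusion labels fresh on the branch): $(\neg^+)$ $w^+:\neg\varphi$ / $v^-:\varphi$; $(\neg^-)$ $w^-:\neg\varphi$ / $v^+:\varphi$; $(\to^+)$ $w^+:\varphi\to\psi$ / $\{v^-:\varphi,u^-:\psi\}\mid\{v^-:\varphi,u^+:\psi\}\mid\{v^+:\varphi,u^+:\psi\}$; $(\to^-)$ $w^-:\varphi\to\psi$ / $\{v^+:\varphi,u^-:\psi\}$; $(\equiv^+)$ $w^+:\varphi\equiv\psi$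 / $\{v^+:\varphi,u^+:\psi,v^+=u^+\}\mid\{v^-:\varphi,u^-:\psi,v^-=u^-\}$; $(\equiv^-)$ $w^-:\varphi\equiv\psi$ / $\{v^+:\varphi,u^+:\psi,v^+\neq u^+\}\mid\{v^+:\varphi,u^-:\psi\}\mid\{v^-:\varphi,u^+:\psi\}\mid\{v^-:\varphi,u^-:\psi,v^-\neq u^-\}$. Equality rules, with $\varphi\approx\psi$ abbreviating premises $w:\varphi$, $v:\psi$, $w=v$: $(\equiv^\neg)$ $\varphi\approx\psi$, $u:\neg\varphi$, $y:\neg\psi$ / $u=y$; $(\equiv^\to)$ $\varphi\approx\psi$, $\chi\approx\theta$, $x:\varphi\to\chi$, $z:\psi\to\theta$ / $x=z$; $(\equiv^\equiv)$ $\varphi\approx\psi$, $\chi\approx\theta$, $x:\varphi\equiv\chi$, $z:\psi\equiv\theta$ / $x=z$; $(\mathsf F)$ $w:\varphi$, $v:\varphi$ / $w=v$; $(\mathsf{sym})$ $w=v$ / $v=w$; $(\mathsf{tran})$ $w=v$, $v=u$ / $w=u$. Closure rules: $(\bot_1)$ $w=v$, $w\neq v$ / $\bot$; $(\bot_2)$ $w^+=v^-$ / $\bot$. A decomposition rule may be applied to $w:\varphi$ on a branch only once; an equality rule only if its conclusion is not yet on the branch; closure rules are applied eagerly. A branch is closed if a closure rule was applied on it, open otherwise; fully expanded if closed or no rule is applicable. Branch structure. Let $\varphi\in\mathsf{FOR}$, $\mathbf{w}^-\in\mathsf{L}^-$, and $\mathcal{B}$ an open fully expanded branch of a tableau with root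 $\mathbf{w}^-:\varphi$. $\mathsf{L}_{\mathcal{B}}$ is the set of labels $w$ with $w:\psi$ on $\mathcal{B}$ for some $\psi$; $\mathsf{L}_{\mathcal{B}}^\pm=\mathsf{L}_{\mathcal{B}}\cap\mathsf{L}^\pm$; $w\sim v$ iff $w=v$ occurs on $\mathcal{B}$ (an equivalence relation on $\mathsf{L}_{\mathcal{B}}$ never relating a label in $\mathsf{L}^+$ to one in $\mathsf{L}^-$). $\mathsf{ML}_{\mathcal{B}}^+$ contains exactly one label from each $\sim$-class of $\mathsf{L}_{\mathcal{B}}^+$; $\mathsf{ML}_{\mathcal{B}}^-$ exactly one label from each $\sim$-class of $\mathsf{L}_{\mathcal{B}}^-$, chosen with $\mathbf{w}^-\in\mathsf{ML}_{\mathcal{B}}^-$; $\mathsf{ML}_{\mathcal{B}}=\mathsf{ML}_{\mathcal{B}}^+\cup\mathsf{ML}_{\mathcal{B}}^-$. Let $\mathbf{w}^+$ be an object not in $\mathsf{L}_{\mathcal{B}}$; for $w\in U$ and a label $t$, "$w\sim t$" is false if $w=\mathbf{w}^+$. $w\in\mathsf{ML}_{\mathcal{B}}$ is $(\neg)$-closed if there are $\psi\in\mathsf{FOR}$, $u\in\mathsf{ML}_{\mathcal{B}}$, $v,t\in\mathsf{L}_{\mathcal{B}}$ with $w\sim v$, $u\sim t$, and $v:\psi$, $t:\neg\psi$ on $\mathcal{B}$. For $\#\in\{\to,\equiv\}$, a pair $(w,v)\in\mathsf{ML}_{\mathcal{B}}^2$ is $(\#)$-closed if there are $\psi,\theta\in\mathsf{FOR}$,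 $u\in\mathsf{ML}_{\mathcal{B}}$, $t,x,y\in\mathsf{L}_{\mathcal{B}}$ with $w\sim t$, $v\sim x$, $u\sim y$ and $t:\psi$, $x:\theta$, $y:(\psi\#\theta)$ on $\mathcal{B}$ ($\mathbf{w}^+$ is never $(\neg)$-closed, and pairs involving it are never closed). Set $D=\mathsf{ML}_{\mathcal{B}}^+\cup\{\mathbf{w}^+\}$, $U=D\cup\mathsf{ML}_{\mathcal{B}}^-$. For $w,v\in U$: $\tilde\neg w=u\in\mathsf{ML}_{\mathcal{B}}$ if there are $\psi$ and $v',t\in\mathsf{L}_{\mathcal{B}}$ with $w\sim v'$, $u\sim t$, $v':\psi$ and $t:\neg\psi$ on $\mathcal{B}$; $\tilde\neg w=\mathbf{w}^+$ if $w$ is not $(\neg)$-closed and $w\notin D$; $\tilde\neg w=\mathbf{w}^-$ otherwise. $w\tilde\to v=u\in\mathsf{ML}_{\mathcal{B}}$ if there are $\psi,\theta$ and $t,x,y\in\mathsf{L}_{\mathcal{B}}$ with $w\sim t$, $v\sim x$, $u\sim y$, $t:\psi$, $x:\theta$, $y:(\psi\to\theta)$ on $\mathcal{B}$; $w\tilde\to v=\mathbf{w}^+$ if $v=\mathbf{w}^+$, or ($w=\mathbf{w}^+$ and $v\in D$), or ($(w,v)$ is not $(\to)$-closed and ($w\notin D$ or $v\in D$)); $w\tilde\to v=\mathbf{w}^-$ otherwise. $w\tilde\equiv v=u\in\mathsf{ML}_{\mathcal{B}}$ if there are $\psi,\theta$ and $t,x,y\in\mathsf{L}_{\mathcal{B}}$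 with $w\sim t$, $v\sim x$, $u\sim y$, $t:\psi$, $x:\theta$, $y:(\psi\equiv\theta)$ on $\mathcal{B}$; $w\tilde\equiv v=\mathbf{w}^+$ if $w=v$ and ($w=\mathbf{w}^+$ or $(w,v)$ is not $(\equiv)$-closed); $w\tilde\equiv v=\mathbf{w}^-$ otherwise. $\mathcal{M}_{\mathcal{B}}=\langle U,D,\tilde\neg,\tilde\to,\tilde\equiv\rangle$. -}

module Defs where

open import Data.Nat using (ℕ)
open import Data.Maybe using (Maybe; just; nothing)
open import Data.List using (List; []; _∷_; _++_; concatMap)
open import Data.List.Membership.Propositional using (_∈_; _∉_)
open import Data.Product using (Σ; _×_; _,_)
open import Data.Sum using (_⊎_)
open import Data.Unit using (⊤)
open import Data.Empty using (⊥)
open import Relation.Nullary using (¬_)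
open import Relation.Binary.PropositionalEquality using (_≡_; _≢_)

data Fm : Set where
  atom  : ℕ → Fm
  ¬'_   : Fm → Fm
  _⇒_   : Fm → Fm → Fm
  _≡'_  : Fm → Fm → Fm

-- Labels: L⁺ = { pl n }, L⁻ = { nl n }  (disjoint, countably infinite)

data Label : Set where
  pl : ℕ → Label
  nl : ℕ → Label

data IsPos : Label → Set where
  isPos : ∀ {n} → IsPos (pl n)

infix 6 _∶_ _≐_ _≠ᵢ_

data Item : Set where
  _∶_  : Label → Fm → Item
  _≐_  : Label → Label → Item
  _≠ᵢ_ : Label → Label → Item
  ⊥ᵢ   : Item

labelsOf : Item → List Label
labelsOf (w ∶ _)  = w ∷ []
labelsOf (w ≐ v)  = w ∷ v ∷ []
labelsOf (w ≠ᵢ v) = w ∷ v ∷ []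
labelsOf ⊥ᵢ       = []

Fresh : Label → List Item → Set
Fresh l B = l ∉ concatMap labelsOf B

-- Alternative conclusion sets of the decomposition rules applied to w : φ
-- on branch B (conclusion labels fresh on B and pairwise distinct).

data DecConcl (B : List Item) : Label → Fm → List Item → Set where
  neg⁺  : ∀ {w a φ} → Fresh (nl a) B →
          DecConcl B (pl w) (¬' φ) (nl a ∶ φ ∷ [])
  neg⁻  : ∀ {w a φ} → Fresh (pl a) B →
          DecConcl B (nl w) (¬' φ) (pl a ∶ φ ∷ [])
  imp⁺₁ : ∀ {w a b φ ψ} → Fresh (nl a) B → Fresh (nl b) B → a ≢ b →
          DecConcl B (pl w) (φ ⇒ ψ) (nl a ∶ φ ∷ nl b ∶ ψ ∷ [])
  imp⁺₂ : ∀ {w a b φ ψ} → Fresh (nl a) B → Fresh (pl b) B →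
          DecConcl B (pl w) (φ ⇒ ψ) (nl a ∶ φ ∷ pl b ∶ ψ ∷ [])
  imp⁺₃ : ∀ {w a b φ ψ} → Fresh (pl a) B → Fresh (pl b) B → a ≢ b →
          DecConcl B (pl w) (φ ⇒ ψ) (pl a ∶ φ ∷ pl b ∶ ψ ∷ [])
  imp⁻  : ∀ {w a b φ ψ} → Fresh (pl a) B → Fresh (nl b) B →
          DecConcl B (nl w) (φ ⇒ ψ) (pl a ∶ φ ∷ nl b ∶ ψ ∷ [])
  eqv⁺₁ : ∀ {w a b φ ψ} → Fresh (pl a) B → Fresh (pl b) B → a ≢ b →
          DecConcl B (pl w) (φ ≡' ψ) (pl a ∶ φ ∷ pl b ∶ ψ ∷ pl a ≐ pl b ∷ [])
  eqv⁺₂ : ∀ {w a b φ ψ} → Fresh (nl a) B → Fresh (nl b) B → a ≢ b →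
          DecConcl B (pl w) (φ ≡' ψ) (nl a ∶ φ ∷ nl b ∶ ψ ∷ nl a ≐ nl b ∷ [])
  eqv⁻₁ : ∀ {w a b φ ψ} → Fresh (pl a) B → Fresh (pl b) B → a ≢ b →
          DecConcl B (nl w) (φ ≡' ψ) (pl a ∶ φ ∷ pl b ∶ ψ ∷ pl a ≠ᵢ pl b ∷ [])
  eqv⁻₂ : ∀ {w a b φ ψ} → Fresh (pl a) B → Fresh (nl b) B →
          DecConcl B (nl w) (φ ≡' ψ) (pl a ∶ φ ∷ nl b ∶ ψ ∷ [])
  eqv⁻₃ : ∀ {w a b φ ψ} → Fresh (nl a) B → Fresh (pl b) B →
          DecConcl B (nl w) (φ ≡' ψ) (nl a ∶ φ ∷ pl b ∶ ψ ∷ [])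
  eqv⁻₄ : ∀ {w a b φ ψ} → Fresh (nl a) B → Fresh (nl b) B → a ≢ b →
          DecConcl B (nl w) (φ ≡' ψ) (nl a ∶ φ ∷ nl b ∶ ψ ∷ nl a ≠ᵢ nl b ∷ [])

-- Branch states: the items on the branch, together with the labelled
-- formulas to which a decomposition rule has already been applied.

record State : Set where
  constructor ⟨_,_⟩
  field
    items : List Item
    used  : List (Label × Fm)
open State public

ClosurePremises : List Item → Set
ClosurePremises B =
  (Σ Label λ w → Σ Label λ v → (w ≐ v) ∈ B × (w ≠ᵢ v) ∈ B)
  ⊎ (Σ ℕ λ a → Σ ℕ λ b → (pl a ≐ nl b) ∈ B)

-- one rule application on a branch (choosing one alternative conclusion
-- set).  Closure rules are eager: no other rule may be applied while the
-- premises of a closure rule are present.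
data Step : State → State → Set where
  dec  : ∀ {B U w φ C} → ¬ ClosurePremises B →
         (w ∶ φ) ∈ B → (w , φ) ∉ U → DecConcl B w φ C →
         Step ⟨ B , U ⟩ ⟨ C ++ B , (w , φ) ∷ U ⟩
  eq¬  : ∀ {B U w v u y φ ψ} → ¬ ClosurePremises B →
         (w ∶ φ) ∈ B → (v ∶ ψ) ∈ B → (w ≐ v) ∈ B →
         (u ∶ ¬' φ) ∈ B → (y ∶ ¬' ψ) ∈ B → (u ≐ y) ∉ B →
         Step ⟨ B , U ⟩ ⟨ (u ≐ y) ∷ B , U ⟩
  eq⇒  : ∀ {B U w v w' v' x z φ ψ χ θ} → ¬ ClosurePremises B →
         (w ∶ φ) ∈ B → (v ∶ ψ) ∈ B → (w ≐ v) ∈ B →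
         (w' ∶ χ) ∈ B → (v' ∶ θ) ∈ B → (w' ≐ v') ∈ B →
         (x ∶ (φ ⇒ χ)) ∈ B → (z ∶ (ψ ⇒ θ)) ∈ B → (x ≐ z) ∉ B →
         Step ⟨ B , U ⟩ ⟨ (x ≐ z) ∷ B , U ⟩
  eq≡  : ∀ {B U w v w' v' x z φ ψ χ θ} → ¬ ClosurePremises B →
         (w ∶ φ) ∈ B → (v ∶ ψ) ∈ B → (w ≐ v) ∈ B →
         (w' ∶ χ) ∈ B → (v' ∶ θ) ∈ B → (w' ≐ v') ∈ B →
         (x ∶ (φ ≡' χ)) ∈ B → (z ∶ (ψ ≡' θ)) ∈ B → (x ≐ z) ∉ B →
         Step ⟨ B , U ⟩ ⟨ (x ≐ z) ∷ B , U ⟩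
  ruleF : ∀ {B U w v φ} → ¬ ClosurePremises B →
         (w ∶ φ) ∈ B → (v ∶ φ) ∈ B → (w ≐ v) ∉ B →
         Step ⟨ B , U ⟩ ⟨ (w ≐ v) ∷ B , U ⟩
  rsym : ∀ {B U w v} → ¬ ClosurePremises B →
         (w ≐ v) ∈ B → (v ≐ w) ∉ B →
         Step ⟨ B , U ⟩ ⟨ (v ≐ w) ∷ B , U ⟩
  rtran : ∀ {B U w v u} → ¬ ClosurePremises B →
         (w ≐ v) ∈ B → (v ≐ u) ∈ B → (w ≐ u) ∉ B →
         Step ⟨ B , U ⟩ ⟨ (w ≐ u) ∷ B , U ⟩
  bot₁ : ∀ {B U w v} → (w ≐ v) ∈ B → (w ≠ᵢ v) ∈ B → ⊥ᵢ ∉ B →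
         Step ⟨ B , U ⟩ ⟨ ⊥ᵢ ∷ B , U ⟩
  bot₂ : ∀ {B U a b} → (pl a ≐ nl b) ∈ B → ⊥ᵢ ∉ B →
         Step ⟨ B , U ⟩ ⟨ ⊥ᵢ ∷ B , U ⟩

data Reach : State → State → Set where
  done : ∀ {S} → Reach S S
  step : ∀ {S S' S''} → Step S S' → Reach S' S'' → Reach S S''

root : ℕ → Fm → State
root r φ = ⟨ (nl r ∶ φ) ∷ [] , [] ⟩

IsBranch : ℕ → Fm → State → Set
IsBranch r φ S = Reach (root r φ) S

Closed Open : State → Set
Closed S = ⊥ᵢ ∈ items S
Open S = ¬ Closed S

FullyExpanded : State → Set
FullyExpanded S = Closed S ⊎ (∀ S' → ¬ Step S S')

InL : List Item → Label → Set
InL B w = Σ Fm λ ψ → (w ∶ ψ) ∈ B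

-- ML_B : exactly one label from each ∼-class of L_B, containing the root
-- label 𝐰⁻ (w ∼ v iff (w = v) occurs on B).
record IsML (B : List Item) (𝐰⁻ : Label) (ML : Label → Set) : Set where
  field
    ml-inL    : ∀ {w} → ML w → InL B w
    ml-cover  : ∀ {w} → InL B w → Σ Label λ m → ML m × (w ≐ m) ∈ B
    ml-unique : ∀ {m m'} → ML m → ML m' → (m ≐ m') ∈ B → m ≡ m'
    ml-root   : ML 𝐰⁻

-- elements of the universe: just w for w ∈ ML_B, nothing for the extra
-- object 𝐰⁺ (not a label)
Elt : Set
Elt = Maybe Label

InU : (Label → Set) → Elt → Set
InU ML nothing  = ⊤
InU ML (just w) = ML w

InD : (Label → Set) → Elt → Set
InD ML nothing  = ⊤
InD ML (just w) = ML w × IsPos w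

Sim : List Item → Elt → Label → Set
Sim B nothing  t = ⊥
Sim B (just w) t = (w ≐ t) ∈ B

ImpClosed : List Item → (Label → Set) → Elt → Elt → Set
ImpClosed B ML w v =
  Σ Fm λ ψ → Σ Fm λ θ → Σ Label λ u → ML u ×
  Σ Label λ t → Σ Label λ x → Σ Label λ y →
  Sim B w t × Sim B v x × (u ≐ y) ∈ B ×
  (t ∶ ψ) ∈ B × (x ∶ θ) ∈ B × (y ∶ (ψ ⇒ θ)) ∈ B

ImpClause₁ : List Item → (Label → Set) → Elt → Elt → Elt → Set
ImpClause₁ B ML w v nothing  = ⊥
ImpClause₁ B ML w v (just u) =
  ML u × Σ Fm λ ψ → Σ Fm λ θ →
  Σ Label λ t → Σ Label λ x → Σ Label λ y →
  Sim B w t × Sim B v x × (u ≐ y) ∈ B ×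
  (t ∶ ψ) ∈ B × (x ∶ θ) ∈ B × (y ∶ (ψ ⇒ θ)) ∈ B

ImpClause₂ : List Item → (Label → Set) → Elt → Elt → Set
ImpClause₂ B ML w v =
  (v ≡ nothing)
  ⊎ (w ≡ nothing × InD ML v)
  ⊎ (¬ ImpClosed B ML w v × (¬ InD ML w ⊎ InD ML v))

ImpRel : List Item → Label → (Label → Set) → Elt → Elt → Elt → Set
ImpRel B 𝐰⁻ ML w v u =
  ImpClause₁ B ML w v u
  ⊎ (u ≡ nothing × ImpClause₂ B ML w v)
  ⊎ (u ≡ just 𝐰⁻ × ¬ (Σ Elt λ u' → ImpClause₁ B ML w v u') × ¬ ImpClause₂ B ML w v)

{-# OPTIONS --safe #-}
module Submission where

-- On an open, fully expanded branch every formula y : ψ → θ has been decomposed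
-- (fresh labels are always available), so rule (F) equates any t : ψ and x : θ
-- with the conclusion labels of that decomposition; as equality never relates a
-- positive to a negative label, y is positive exactly when t is negative or x is
-- positive.  Hence the value w →̃ v given by the first clause is designated iff
-- w ∉ D or v ∈ D, and rule (≡→) makes that value unique.  The remaining clauses
-- are mutually exclusive and decidable on the finite branch, and they satisfy the
-- claim by their very shape.

open import Defs
open import Data.Nat using (ℕ; _⊔_; _≤_; _<_)
open import Data.Nat.Properties as ℕₚ using (m≤m⊔n; m≤n⊔m; ≤-trans; <⇒≱; <⇒≢; n<1+n; m<n⇒m<1+n)
open import Data.Bool using (Bool; true; false; not; _∨_)
open import Data.Maybe using (just; nothing)
open import Data.List using (List; []; _∷_; concatMap)
open import Data.List.Relation.Unary.Any using (here; there)
open import Data.List.Membership.Propositional using (_∈_)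
open import Data.List.Relation.Binary.Subset.Propositional using (_⊆_)
open import Data.List.Relation.Binary.Subset.Propositional.Properties using (xs⊆xs++ys; xs⊆ys++xs)
open import Data.Product using (Σ; ∃₂; _×_; _,_; proj₁; proj₂)
open import Data.Product.Properties using (≡-dec)
open import Data.Sum using (_⊎_; inj₁; inj₂)
open import Data.Unit using (tt)
open import Data.Empty using (⊥; ⊥-elim)
open import Relation.Nullary using (¬_; Dec; yes; no)
open import Relation.Nullary.Decidable using (map′; _×-dec_; _⊎-dec_; ¬?)
open import Relation.Binary.Definitions using (DecidableEquality)
open import Relation.Binary.PropositionalEquality using (_≡_; refl; cong; cong₂; trans; module ≡-Reasoning)
open import Function.Bundles using (_⇔_; mk⇔)
import Data.List.Membership.DecPropositional as DecMembership

_≟ᶠ_ : DecidableEquality Fm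
atom n ≟ᶠ atom m with n ℕₚ.≟ m
... | yes refl = yes refl
... | no n≢m = no λ { refl → n≢m refl }
(¬' φ) ≟ᶠ (¬' ψ) with φ ≟ᶠ ψ
... | yes refl = yes refl
... | no φ≢ψ = no λ { refl → φ≢ψ refl }
(φ ⇒ χ) ≟ᶠ (ψ ⇒ θ) with φ ≟ᶠ ψ | χ ≟ᶠ θ
... | yes refl | yes refl = yes refl
... | no φ≢ψ | _ = no λ { refl → φ≢ψ refl }
... | _ | no χ≢θ = no λ { refl → χ≢θ refl }
(φ ≡' χ) ≟ᶠ (ψ ≡' θ) with φ ≟ᶠ ψ | χ ≟ᶠ θ
... | yes refl | yes refl = yes refl
... | no φ≢ψ | _ = no λ { refl → φ≢ψ refl }
... | _ | no χ≢θ = no λ { refl → χ≢θ refl }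
atom _ ≟ᶠ (¬' _) = no λ ()
atom _ ≟ᶠ (_ ⇒ _) = no λ ()
atom _ ≟ᶠ (_ ≡' _) = no λ ()
(¬' _) ≟ᶠ atom _ = no λ ()
(¬' _) ≟ᶠ (_ ⇒ _) = no λ ()
(¬' _) ≟ᶠ (_ ≡' _) = no λ ()
(_ ⇒ _) ≟ᶠ atom _ = no λ ()
(_ ⇒ _) ≟ᶠ (¬' _) = no λ ()
(_ ⇒ _) ≟ᶠ (_ ≡' _) = no λ ()
(_ ≡' _) ≟ᶠ atom _ = no λ ()
(_ ≡' _) ≟ᶠ (¬' _) = no λ ()
(_ ≡' _) ≟ᶠ (_ ⇒ _) = no λ ()

_≟ˡ_ : DecidableEquality Label
pl n ≟ˡ pl m = map′ (cong pl) (λ { refl → refl }) (n ℕₚ.≟ m)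
nl n ≟ˡ nl m = map′ (cong nl) (λ { refl → refl }) (n ℕₚ.≟ m)
pl _ ≟ˡ nl _ = no λ ()
nl _ ≟ˡ pl _ = no λ ()

_≟ⁱ_ : DecidableEquality Item
(w ∶ φ) ≟ⁱ (v ∶ ψ) =
  map′ (λ { (refl , refl) → refl }) (λ { refl → refl , refl }) ((w ≟ˡ v) ×-dec (φ ≟ᶠ ψ))
(w ≐ w') ≟ⁱ (v ≐ v') =
  map′ (λ { (refl , refl) → refl }) (λ { refl → refl , refl }) ((w ≟ˡ v) ×-dec (w' ≟ˡ v'))
(w ≠ᵢ w') ≟ⁱ (v ≠ᵢ v') =
  map′ (λ { (refl , refl) → refl }) (λ { refl → refl , refl }) ((w ≟ˡ v) ×-dec (w' ≟ˡ v'))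
⊥ᵢ ≟ⁱ ⊥ᵢ = yes refl
(_ ∶ _) ≟ⁱ (_ ≐ _) = no λ ()
(_ ∶ _) ≟ⁱ (_ ≠ᵢ _) = no λ ()
(_ ∶ _) ≟ⁱ ⊥ᵢ = no λ ()
(_ ≐ _) ≟ⁱ (_ ∶ _) = no λ ()
(_ ≐ _) ≟ⁱ (_ ≠ᵢ _) = no λ ()
(_ ≐ _) ≟ⁱ ⊥ᵢ = no λ ()
(_ ≠ᵢ _) ≟ⁱ (_ ∶ _) = no λ ()
(_ ≠ᵢ _) ≟ⁱ (_ ≐ _) = no λ ()
(_ ≠ᵢ _) ≟ⁱ ⊥ᵢ = no λ ()
⊥ᵢ ≟ⁱ (_ ∶ _) = no λ ()
⊥ᵢ ≟ⁱ (_ ≐ _) = no λ ()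
⊥ᵢ ≟ⁱ (_ ≠ᵢ _) = no λ ()

open DecMembership _≟ⁱ_ using (_∈?_)
open DecMembership (≡-dec _≟ˡ_ _≟ᶠ_) using () renaming (_∈?_ to _∈ᵘ?_)

LabelledIn : List Item → (Label → Fm → Set) → Set
LabelledIn B P = ∃₂ λ t ψ → (t ∶ ψ) ∈ B × P t ψ

labelledIn-there : ∀ {i B P} → LabelledIn B P → LabelledIn (i ∷ B) P
labelledIn-there (t , ψ , j , p) = t , ψ , there j , p

labelledIn? : ∀ B {P} → (∀ t ψ → Dec (P t ψ)) → Dec (LabelledIn B P)
labelledIn? [] P? = no λ { (_ , _ , () , _) }
labelledIn? ((t ∶ ψ) ∷ B) P? with P? t ψ | labelledIn? B P?
... | yes p | _      = yes (t , ψ , here refl , p)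
... | no _  | yes q  = yes (labelledIn-there q)
... | no ¬p | no ¬q  = no λ { (_ , _ , here refl , p) → ¬p p
                            ; (t' , ψ' , there j , p) → ¬q (t' , ψ' , j , p) }
labelledIn? ((_ ≐ _) ∷ B) P? =
  map′ labelledIn-there (λ { (t , ψ , there j , p) → t , ψ , j , p }) (labelledIn? B P?)
labelledIn? ((_ ≠ᵢ _) ∷ B) P? =
  map′ labelledIn-there (λ { (t , ψ , there j , p) → t , ψ , j , p }) (labelledIn? B P?)
labelledIn? (⊥ᵢ ∷ B) P? =
  map′ labelledIn-there (λ { (t , ψ , there j , p) → t , ψ , j , p }) (labelledIn? B P?)

index : Label → ℕ
index (pl n) = n
index (nl n) = n

maxIndex : List Label → ℕ
maxIndex [] = 0
maxIndex (l ∷ ls) = index l ⊔ maxIndex ls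

index≤maxIndex : ∀ {l ls} → l ∈ ls → index l ≤ maxIndex ls
index≤maxIndex {l} {_ ∷ ls} (here refl) = m≤m⊔n (index l) (maxIndex ls)
index≤maxIndex {_} {l' ∷ _} (there l∈) = ≤-trans (index≤maxIndex l∈) (m≤n⊔m (index l') _)

bound : List Item → ℕ
bound B = maxIndex (concatMap labelsOf B)

fresh-pl : ∀ B {n} → bound B < n → Fresh (pl n) B
fresh-pl B B<n l∈ = <⇒≱ B<n (index≤maxIndex l∈)

fresh-nl : ∀ B {n} → bound B < n → Fresh (nl n) B
fresh-nl B B<n l∈ = <⇒≱ B<n (index≤maxIndex l∈)

positive : Label → Bool
positive (pl _) = true
positive (nl _) = false

impConcl-sign : ∀ {B y ψ θ C} → DecConcl B y (ψ ⇒ θ) C →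
                Σ Label λ a → Σ Label λ b →
                (a ∶ ψ) ∈ C × (b ∶ θ) ∈ C × positive y ≡ (not (positive a) ∨ positive b)
impConcl-sign (imp⁺₁ _ _ _) = _ , _ , here refl , there (here refl) , refl
impConcl-sign (imp⁺₂ _ _)   = _ , _ , here refl , there (here refl) , refl
impConcl-sign (imp⁺₃ _ _ _) = _ , _ , here refl , there (here refl) , refl
impConcl-sign (imp⁻ _ _)    = _ , _ , here refl , there (here refl) , refl

-- The bookkeeping list `used` is only meaningful together with this invariant:
-- the conclusions of every recorded decomposition are still on the branch.
DecompositionsOnBranch : State → Set
DecompositionsOnBranch S = ∀ {w φ} → (w , φ) ∈ used S →
  Σ (List Item) λ B' → Σ (List Item) λ C → DecConcl B' w φ C × C ⊆ items S

cons-preserves : ∀ {i B U} → DecompositionsOnBranch ⟨ B , U ⟩ → DecompositionsOnBranch ⟨ i ∷ B , U ⟩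
cons-preserves inv p = let B' , C , d , C⊆B = inv p in B' , C , d , λ c → there (C⊆B c)

step-preserves : ∀ {S S'} → Step S S' → DecompositionsOnBranch S → DecompositionsOnBranch S'
step-preserves (dec {B} {C = C} _ _ _ d) _ (here refl) = B , C , d , xs⊆xs++ys C B
step-preserves (dec {B} {C = C} _ _ _ _) inv (there p) =
  let B' , C' , d , C'⊆B = inv p in B' , C' , d , λ c → xs⊆ys++xs B C (C'⊆B c)
step-preserves (eq¬ _ _ _ _ _ _ _)        = cons-preserves
step-preserves (eq⇒ _ _ _ _ _ _ _ _ _ _) = cons-preserves
step-preserves (eq≡ _ _ _ _ _ _ _ _ _ _) = cons-preserves
step-preserves (ruleF _ _ _ _)            = cons-preserves
step-preserves (rsym _ _ _)               = cons-preserves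
step-preserves (rtran _ _ _ _)            = cons-preserves
step-preserves (bot₁ _ _ _)               = cons-preserves
step-preserves (bot₂ _ _)                 = cons-preserves

branch-decompositions : ∀ {r φ S} → IsBranch r φ S → DecompositionsOnBranch S
branch-decompositions = go (λ ())
  where
    go : ∀ {S S'} → DecompositionsOnBranch S → Reach S S' → DecompositionsOnBranch S'
    go inv done = inv
    go inv (step s r) = go (step-preserves s inv) r

module SaturatedBranch (S : State) (open-S : Open S) (no-step : ∀ S' → ¬ Step S S')
                       (decomposed : DecompositionsOnBranch S) where

  B : List Item
  B = items S

  no-closure : ¬ ClosurePremises B
  no-closure (inj₁ (_ , _ , e , n)) = no-step _ (bot₁ e n open-S)
  no-closure (inj₂ (_ , _ , e))     = no-step _ (bot₂ e open-S)

  -- Each closure property: the item is on B, for otherwise the rule adding it applies.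
  ≐-sym : ∀ {w v} → (w ≐ v) ∈ B → (v ≐ w) ∈ B
  ≐-sym {w} {v} e with (v ≐ w) ∈? B
  ... | yes e' = e'
  ... | no ∉B = ⊥-elim (no-step _ (rsym no-closure e ∉B))

  ≐-trans : ∀ {w v u} → (w ≐ v) ∈ B → (v ≐ u) ∈ B → (w ≐ u) ∈ B
  ≐-trans {w} {u = u} e e' with (w ≐ u) ∈? B
  ... | yes e'' = e''
  ... | no ∉B = ⊥-elim (no-step _ (rtran no-closure e e' ∉B))

  same-formula-≐ : ∀ {w v φ} → (w ∶ φ) ∈ B → (v ∶ φ) ∈ B → (w ≐ v) ∈ B
  same-formula-≐ {w} {v} w∈ v∈ with (w ≐ v) ∈? B
  ... | yes e = e
  ... | no ∉B = ⊥-elim (no-step _ (ruleF no-closure w∈ v∈ ∉B))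

  ⇒-congruent : ∀ {w v w' v' x z φ ψ χ θ} →
                (w ∶ φ) ∈ B → (v ∶ ψ) ∈ B → (w ≐ v) ∈ B →
                (w' ∶ χ) ∈ B → (v' ∶ θ) ∈ B → (w' ≐ v') ∈ B →
                (x ∶ (φ ⇒ χ)) ∈ B → (z ∶ (ψ ⇒ θ)) ∈ B → (x ≐ z) ∈ B
  ⇒-congruent {x = x} {z = z} a b c d e f g h with (x ≐ z) ∈? B
  ... | yes e' = e'
  ... | no ∉B = ⊥-elim (no-step _ (eq⇒ no-closure a b c d e f g h ∉B))

  positive-resp-≐ : ∀ {l l'} → (l ≐ l') ∈ B → positive l ≡ positive l'
  positive-resp-≐ {pl _} {pl _} _ = refl
  positive-resp-≐ {nl _} {nl _} _ = refl
  positive-resp-≐ {pl a} {nl b} e = ⊥-elim (no-closure (inj₂ (a , b , e)))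
  positive-resp-≐ {nl a} {pl b} e = ⊥-elim (no-closure (inj₂ (b , a , ≐-sym e)))

  ⇒-used : ∀ {y ψ θ} → (y ∶ (ψ ⇒ θ)) ∈ B → (y , (ψ ⇒ θ)) ∈ used S
  ⇒-used {y} {ψ} {θ} y∈ with (y , (ψ ⇒ θ)) ∈ᵘ? used S
  ... | yes u = u
  ⇒-used {pl _} y∈ | no ∉U =
    ⊥-elim (no-step _ (dec no-closure y∈ ∉U
      (imp⁺₁ (fresh-nl B (n<1+n _)) (fresh-nl B (m<n⇒m<1+n (n<1+n _))) (<⇒≢ (n<1+n _)))))
  ⇒-used {nl _} y∈ | no ∉U =
    ⊥-elim (no-step _ (dec no-closure y∈ ∉U (imp⁻ (fresh-pl B (n<1+n _)) (fresh-nl B (n<1+n _)))))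

  ⇒-sign : ∀ {y t x ψ θ} → (t ∶ ψ) ∈ B → (x ∶ θ) ∈ B → (y ∶ (ψ ⇒ θ)) ∈ B →
           positive y ≡ (not (positive t) ∨ positive x)
  ⇒-sign t∈ x∈ y∈ =
    let _ , C , d , C⊆B = decomposed (⇒-used y∈)
        a , b , a∈ , b∈ , sign = impConcl-sign d
    in trans sign (cong₂ (λ p q → not p ∨ q)
                    (positive-resp-≐ (same-formula-≐ (C⊆B a∈) t∈))
                    (positive-resp-≐ (same-formula-≐ (C⊆B b∈) x∈)))

  module BranchStructure (r : ℕ) (ML : Label → Set) (isML : IsML B (nl r) ML) where
    open IsML isML

    ImpInstance : Elt → Elt → Set
    ImpInstance w v = Σ Fm λ ψ → Σ Fm λ θ → Σ Label λ t → Σ Label λ x → Σ Label λ y →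
      Sim B w t × Sim B v x × (t ∶ ψ) ∈ B × (x ∶ θ) ∈ B × (y ∶ (ψ ⇒ θ)) ∈ B

    sim? : ∀ w t → Dec (Sim B w t)
    sim? nothing  _ = no λ ()
    sim? (just w) t = (w ≐ t) ∈? B

    OccursAt : Elt → Fm → Set
    OccursAt w ψ = Σ Label λ t → Sim B w t × (t ∶ ψ) ∈ B

    occursAt? : ∀ w ψ → Dec (OccursAt w ψ)
    occursAt? w ψ =
      map′ (λ { (t , _ , t∈ , refl , s) → t , s , t∈ }) (λ (t , s , t∈) → t , ψ , t∈ , refl , s)
           (labelledIn? B (λ t ψ' → (ψ' ≟ᶠ ψ) ×-dec sim? w t))

    ImpOver : Elt → Elt → Fm → Set
    ImpOver w v (ψ ⇒ θ) = OccursAt w ψ × OccursAt v θ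
    ImpOver w v _       = ⊥

    impOver? : ∀ w v χ → Dec (ImpOver w v χ)
    impOver? w v (ψ ⇒ θ) = occursAt? w ψ ×-dec occursAt? v θ
    impOver? w v (atom _) = no λ ()
    impOver? w v (¬' _)   = no λ ()
    impOver? w v (_ ≡' _) = no λ ()

    impInstance? : ∀ w v → Dec (ImpInstance w v)
    impInstance? w v = map′ instance-of (λ (ψ , θ , t , x , y , s , s' , t∈ , x∈ , y∈) →
                                          y , ψ ⇒ θ , y∈ , (t , s , t∈) , (x , s' , x∈))
                            (labelledIn? B (λ _ → impOver? w v))
      where
        instance-of : LabelledIn B (λ _ → ImpOver w v) → ImpInstance w v
        instance-of (y , ψ ⇒ θ , y∈ , (t , s , t∈) , (x , s' , x∈)) =
          ψ , θ , t , x , y , s , s' , t∈ , x∈ , y∈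

    instance⇒clause₁ : ∀ {w v} → ImpInstance w v → Σ Elt (ImpClause₁ B ML w v)
    instance⇒clause₁ (ψ , θ , t , x , y , s , s' , t∈ , x∈ , y∈) =
      let m , m∈ML , y≐m = ml-cover (ψ ⇒ θ , y∈)
      in just m , m∈ML , ψ , θ , t , x , y , s , s' , ≐-sym y≐m , t∈ , x∈ , y∈

    clause₁⇒instance : ∀ {w v u} → ImpClause₁ B ML w v u → ImpInstance w v
    clause₁⇒instance {u = just _} (_ , ψ , θ , t , x , y , s , s' , _ , t∈ , x∈ , y∈) =
      ψ , θ , t , x , y , s , s' , t∈ , x∈ , y∈

    instance⇒closed : ∀ {w v} → ImpInstance w v → ImpClosed B ML w v
    instance⇒closed (ψ , θ , t , x , y , s , s' , t∈ , x∈ , y∈) =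
      let m , m∈ML , y≐m = ml-cover (ψ ⇒ θ , y∈)
      in ψ , θ , m , m∈ML , t , x , y , s , s' , ≐-sym y≐m , t∈ , x∈ , y∈

    closed⇒instance : ∀ {w v} → ImpClosed B ML w v → ImpInstance w v
    closed⇒instance (ψ , θ , _ , _ , t , x , y , s , s' , _ , t∈ , x∈ , y∈) =
      ψ , θ , t , x , y , s , s' , t∈ , x∈ , y∈

    clause₁-inU : ∀ {w v u} → ImpClause₁ B ML w v u → InU ML u
    clause₁-inU {u = just _} (m∈ML , _) = m∈ML

    -- Both values are ML-representatives of labels y, y' of ⇒-formulas whose
    -- components are ∼-related, so rule (≡→) gives y ∼ y'.
    clause₁-unique : ∀ {w v u u'} → ImpClause₁ B ML w v u → ImpClause₁ B ML w v u' → u ≡ u'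
    clause₁-unique {just _} {just _} {just _} {just _}
      (m∈ML , _ , _ , _ , _ , _ , w≐t , v≐x , m≐y , t∈ , x∈ , y∈)
      (m'∈ML , _ , _ , _ , _ , _ , w≐t' , v≐x' , m'≐y' , t'∈ , x'∈ , y'∈) =
      cong just (ml-unique m∈ML m'∈ML (≐-trans m≐y (≐-trans y≐y' (≐-sym m'≐y'))))
      where
        y≐y' : (_ ≐ _) ∈ B
        y≐y' = ⇒-congruent t∈ t'∈ (≐-trans (≐-sym w≐t) w≐t')
                           x∈ x'∈ (≐-trans (≐-sym v≐x) v≐x') y∈ y'∈

    clause₁-excludes-clause₂ : ∀ {w v u} → ImpClause₁ B ML w v u → ¬ ImpClause₂ B ML w v
    clause₁-excludes-clause₂ {just _} {just _} {just _} c (inj₁ ())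
    clause₁-excludes-clause₂ {just _} {just _} {just _} c (inj₂ (inj₁ (() , _)))
    clause₁-excludes-clause₂ {just _} {just _} {just _} c (inj₂ (inj₂ (open-pair , _))) =
      open-pair (instance⇒closed (clause₁⇒instance c))

    inD? : ∀ e → InU ML e → Dec (InD ML e)
    inD? nothing       _    = yes tt
    inD? (just (pl _)) m∈ML = yes (m∈ML , isPos)
    inD? (just (nl _)) _    = no λ { (_ , ()) }

    isNothing? : (e : Elt) → Dec (e ≡ nothing)
    isNothing? nothing  = yes refl
    isNothing? (just _) = no λ ()

    clause₂? : ∀ w v → InU ML w → InU ML v → Dec (ImpClause₂ B ML w v)
    clause₂? w v w∈U v∈U =
      isNothing? v ⊎-dec (isNothing? w ×-dec inD? v v∈U) ⊎-dec
      (¬? (map′ instance⇒closed closed⇒instance (impInstance? w v))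
         ×-dec (¬? (inD? w w∈U) ⊎-dec inD? v v∈U))

    designated-by-sign : ∀ m w v → ML m → ML w → ML v → positive m ≡ (not (positive w) ∨ positive v) →
                         InD ML (just m) ⇔ (¬ InD ML (just w) ⊎ InD ML (just v))
    designated-by-sign (pl _) (pl _) (pl _) m∈ _ v∈ _ = mk⇔ (λ _ → inj₂ (v∈ , isPos)) (λ _ → m∈ , isPos)
    designated-by-sign (pl _) (nl _) _      m∈ _ _  _ = mk⇔ (λ _ → inj₁ λ { (_ , ()) }) (λ _ → m∈ , isPos)
    designated-by-sign (nl _) (pl _) (nl _) _ w∈ _  _ =
      mk⇔ (λ { (_ , ()) }) (λ { (inj₁ w∉D) → ⊥-elim (w∉D (w∈ , isPos)) ; (inj₂ (_ , ())) })
    designated-by-sign (pl _) (pl _) (nl _) _ _ _ ()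
    designated-by-sign (nl _) (pl _) (pl _) _ _ _ ()
    designated-by-sign (nl _) (nl _) _      _ _ _ ()

    clause₁-designated : ∀ {w v u} → InU ML w → InU ML v → ImpClause₁ B ML w v u →
                         InD ML u ⇔ (¬ InD ML w ⊎ InD ML v)
    clause₁-designated {just w} {just v} {just m} w∈ v∈
      (m∈ , _ , _ , t , x , y , w≐t , v≐x , m≐y , t∈ , x∈ , y∈) =
      designated-by-sign m w v m∈ w∈ v∈ (begin
        positive m                            ≡⟨ positive-resp-≐ m≐y ⟩
        positive y                            ≡⟨ ⇒-sign t∈ x∈ y∈ ⟩
        not (positive t) ∨ positive x         ≡⟨ cong₂ (λ p q → not p ∨ q) (positive-resp-≐ w≐t) (positive-resp-≐ v≐x) ⟨
        not (positive w) ∨ positive v         ∎)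
      where open ≡-Reasoning

    imp-designated : ∀ w v u → InU ML w → InU ML v → ImpRel B (nl r) ML w v u →
                     InD ML u ⇔ (¬ InD ML w ⊎ InD ML v)
    imp-designated w v u w∈ v∈ (inj₁ c) = clause₁-designated w∈ v∈ c
    imp-designated w v _ _ _ (inj₂ (inj₁ (refl , inj₁ refl)))               = mk⇔ (λ _ → inj₂ tt) (λ _ → tt)
    imp-designated w v _ _ _ (inj₂ (inj₁ (refl , inj₂ (inj₁ (_ , v∈D)))))   = mk⇔ (λ _ → inj₂ v∈D) (λ _ → tt)
    imp-designated w v _ _ _ (inj₂ (inj₁ (refl , inj₂ (inj₂ (_ , cond))))) = mk⇔ (λ _ → cond) (λ _ → tt)
    imp-designated w v _ _ _ (inj₂ (inj₂ (refl , no-clause₁ , no-clause₂))) = mk⇔ (λ { (_ , ()) }) contradiction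
      where
        -- If the condition held, clause 1 or clause 2 would apply.
        contradiction : ¬ InD ML w ⊎ InD ML v → InD ML (just (nl r))
        contradiction cond with impInstance? w v
        ... | yes i = ⊥-elim (no-clause₁ (instance⇒clause₁ i))
        ... | no ¬i = ⊥-elim (no-clause₂ (inj₂ (inj₂ ((λ c → ¬i (closed⇒instance c)) , cond))))

    imp-unique-value : ∀ w v → InU ML w → InU ML v →
                       Σ Elt λ u → InU ML u × ImpRel B (nl r) ML w v u
                         × (∀ u' → ImpRel B (nl r) ML w v u' → u' ≡ u)
    imp-unique-value w v w∈ v∈ with impInstance? w v | clause₂? w v w∈ v∈
    ... | yes i | _ = u , clause₁-inU c , inj₁ c , unique
      where
        u = proj₁ (instance⇒clause₁ i)
        c = proj₂ (instance⇒clause₁ i)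
        unique : ∀ u' → ImpRel B (nl r) ML w v u' → u' ≡ u
        unique _ (inj₁ c')                 = clause₁-unique c' c
        unique _ (inj₂ (inj₁ (_ , c₂)))    = ⊥-elim (clause₁-excludes-clause₂ c c₂)
        unique _ (inj₂ (inj₂ (_ , ¬c , _))) = ⊥-elim (¬c (u , c))
    ... | no ¬i | yes c₂ = nothing , tt , inj₂ (inj₁ (refl , c₂)) , unique
      where
        unique : ∀ u' → ImpRel B (nl r) ML w v u' → u' ≡ nothing
        unique _ (inj₁ c')                   = ⊥-elim (¬i (clause₁⇒instance c'))
        unique _ (inj₂ (inj₁ (u'≡ , _)))     = u'≡
        unique _ (inj₂ (inj₂ (_ , _ , ¬c₂))) = ⊥-elim (¬c₂ c₂)
    ... | no ¬i | no ¬c₂ =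
      just (nl r) , ml-root , inj₂ (inj₂ (refl , (λ (_ , c) → ¬i (clause₁⇒instance c)) , ¬c₂)) , unique
      where
        unique : ∀ u' → ImpRel B (nl r) ML w v u' → u' ≡ just (nl r)
        unique _ (inj₁ c')                 = ⊥-elim (¬i (clause₁⇒instance c'))
        unique _ (inj₂ (inj₁ (_ , c₂)))    = ⊥-elim (¬c₂ c₂)
        unique _ (inj₂ (inj₂ (u'≡ , _)))   = u'≡

proposition8 : (φ : Fm) (r : ℕ) (S : State) →
    IsBranch r φ S → Open S → FullyExpanded S →
    (ML : Label → Set) → IsML (items S) (nl r) ML →
    (w v : Elt) → InU ML w → InU ML v →
    (Σ Elt λ u → InU ML u × ImpRel (items S) (nl r) ML w v u
       × (∀ u' → ImpRel (items S) (nl r) ML w v u' → u' ≡ u))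
    × (∀ u → ImpRel (items S) (nl r) ML w v u →
         (InD ML u ⇔ (¬ InD ML w ⊎ InD ML v)))
proposition8 φ r S branch open-S (inj₁ closed) ML isML w v w∈ v∈ = ⊥-elim (open-S closed)
proposition8 φ r S branch open-S (inj₂ no-step) ML isML w v w∈ v∈ =
  imp-unique-value w v w∈ v∈ , λ u → imp-designated w v u w∈ v∈
  where
    open SaturatedBranch S open-S no-step (branch-decompositions branch)
    open BranchStructure r ML isML
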